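{- Let $p$ be a prime and let $A=(a_{ij})$ be an $n\times n$ subring matrix with diagonal $(p^{e_1}, \ldots, p^{e_{n-1}}, 1)$, where $e_1,\dots,e_{n-1}\ge0$. Let $I\subseteq\{1,\dots,n-1\}$ be the set of indices $j$ with $e_j \neq 0$. \begin{enumerate} \item If $i \in I$ and $j_1, j_2 \in \{1,2,\ldots, n\} \setminus I$ with $j_1 \neq j_2$, then $a_{ij_1} = 0$ or $a_{ij_2} = 0$. \item If $i\in I$, then there exists exactly one $j \in \{1,2,\ldots, n\} \setminus I$ with $a_{ij} = 1$. \end{enumerate}
   Context: For $u,w\in\mathbb Z^n$, $u\circ w$ is the componentwise product. An invertible matrix $A=(a_{ij})\in M_n(\mathbb Z)$ is in Hermite normal form if it is upper triangular and $0\le a_{ij}<a_{ii}$ for $1\le i<j\le n$. A subring matrix is an invertible integer matrix in Hermite normal form whose column span contains $(1,\dots,1)^T$ and is closed under $\circ$ (i.e. its column span is a subring of $\mathbb Z^n$). -}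

module Defs where

open import Data.Nat as ℕ using (ℕ; zero; suc)
open import Data.Fin using (Fin; zero; suc; inject₁; fromℕ; _<_)
open import Data.Integer as ℤ using (ℤ; +_)
open import Data.Rational as ℚ using (ℚ; 0ℚ; 1ℚ)
open import Data.Product using (Σ; ∃; _×_)
open import Relation.Binary.PropositionalEquality using (_≡_)
open import Relation.Nullary using (¬_)

-- n × n integer matrices, entries A i j (row i, column j), indices 0..n-1
Matrix : Set → ℕ → Set
Matrix R n = Fin n → Fin n → R

Σℤ : ∀ {n} → (Fin n → ℤ) → ℤ
Σℤ {zero}  f = + 0
Σℤ {suc n} f = f zero ℤ.+ Σℤ (λ i → f (suc i))

Σℚ : ∀ {n} → (Fin n → ℚ) → ℚ
Σℚ {zero}  f = 0ℚ
Σℚ {suc n} f = f zero ℚ.+ Σℚ (λ i → f (suc i))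

_·_ : ∀ {n} → Matrix ℤ n → (Fin n → ℤ) → (Fin n → ℤ)
(A · x) i = Σℤ (λ j → A i j ℤ.* x j)

_⊙_ : ∀ {n} → (Fin n → ℤ) → (Fin n → ℤ) → (Fin n → ℤ)
(u ⊙ w) i = u i ℤ.* w i

toℚ : ℤ → ℚ
toℚ z = z ℚ./ 1

identityℚ : ∀ {n} → Fin n → Fin n → ℚ
identityℚ zero    zero    = 1ℚ
identityℚ zero    (suc j) = 0ℚ
identityℚ (suc i) zero    = 0ℚ
identityℚ (suc i) (suc j) = identityℚ i j

-- A invertible (as a matrix over ℚ, i.e. nonsingular): there is a rational
-- matrix B with A B = I and B A = I
Invertible : ∀ {n} → Matrix ℤ n → Set
Invertible {n} A = Σ (Matrix ℚ n) λ B →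
  (∀ i k → Σℚ (λ j → toℚ (A i j) ℚ.* B j k) ≡ identityℚ i k) ×
  (∀ i k → Σℚ (λ j → B i j ℚ.* toℚ (A j k)) ≡ identityℚ i k)

IsHNF : ∀ {n} → Matrix ℤ n → Set
IsHNF A = (∀ i j → j < i → A i j ≡ + 0) ×
          (∀ i j → i < j → (+ 0 ℤ.≤ A i j) × (A i j ℤ.< A i i))

InColSpan : ∀ {n} → Matrix ℤ n → (Fin n → ℤ) → Set
InColSpan A v = ∃ λ x → ∀ i → (A · x) i ≡ v i

IsSubringMatrix : ∀ {n} → Matrix ℤ n → Set
IsSubringMatrix A =
  Invertible A × IsHNF A ×
  InColSpan A (λ _ → + 1) ×
  (∀ u w → InColSpan A u → InColSpan A w → InColSpan A (u ⊙ w))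

HasDiagonal : ∀ {m} → Matrix ℤ (suc m) → ℕ → (Fin m → ℕ) → Set
HasDiagonal {m} A p e =
  (∀ k → A (inject₁ k) (inject₁ k) ≡ + (p ℕ.^ e k)) ×
  (A (fromℕ m) (fromℕ m) ≡ + 1)

-- I = { j ∈ {1,…,m} : e_j ≠ 0 }, viewed inside the index set Fin (suc m)
InI : ∀ {m} → (Fin m → ℕ) → Fin (suc m) → Set
InI e j = ∃ λ k → (j ≡ inject₁ k) × ¬ (e k ≡ 0)

{-# OPTIONS --safe #-}
-- Call column j a unit column when its pivot A j j is 1; by the hypothesis on the diagonal these are
-- exactly the columns outside I. Everything rests on one property of the column span L of an upper
-- triangular matrix with nonzero pivots: back substitution shows that a vector v of L is zero as soon
-- as every entry v l divisible by the pivot A l l is zero. Applied to c ⊙ c - c for a unit column c,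
-- together with 0 ≤ A l j < p ^ f and the fact that p ^ f dividing a (a - 1) forces p ^ f ∣ a or
-- p ^ f ∣ a - 1, it shows that unit columns are 0/1 vectors. Applied to c ⊙ c′ it shows that distinct
-- unit columns have disjoint supports: a common 1 in row l would force A l l ∣ 1, making l the pivot
-- row of both. Applied to 1 - Σ c, the sum over all unit columns, it shows that every row has a 1 in
-- some unit column.
module Submission where

open import Data.Nat.Base as ℕ using (ℕ; zero; suc)
open import Data.Nat.Primality using (Prime; ¬prime[0]; ¬prime[1])
open import Data.Sum using (_⊎_; inj₁; inj₂; map₂; fromInj₂)
open import Function.Base using (_∘_)
open import Relation.Binary.PropositionalEquality
open import Relation.Nullary using (¬_; contradiction; yes; no)

module PrimePowerDivisibility where
  open import Data.Nat.Base using (_*_; _^_; _<_)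
  open import Data.Nat.Properties using (*-comm; *-assoc; +-comm; n<1+n; <-trans)
  open import Data.Nat.Divisibility
  open import Data.Nat.Primality using (euclidsLemma; prime⇒nonZero)

  ∣∧<⇒≡0 : ∀ {m n} → m ∣ n → n < m → n ≡ 0
  ∣∧<⇒≡0 {n = zero}  _   _   = refl
  ∣∧<⇒≡0 {n = suc _} m∣n n<m = contradiction m∣n (>⇒∤ n<m)

  module _ {p : ℕ} (p-prime : Prime p) where

    private instance
      p≢0 = prime⇒nonZero p-prime

    p∤1 : ¬ p ∣ 1
    p∤1 p∣1 with ∣1⇒≡1 p∣1
    ... | refl = ¬prime[1] p-prime

    prime^∣m*n∧∤m⇒∣n : ∀ {m n} e → ¬ p ∣ m → p ^ e ∣ m * n → p ^ e ∣ n
    prime^∣m*n∧∤m⇒∣n {n = n} zero    _   _        = 1∣ n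
    prime^∣m*n∧∤m⇒∣n {m} {n} (suc e) p∤m pᵉ⁺¹∣mn
      with euclidsLemma m n p-prime (∣-trans (m∣m*n (p ^ e)) pᵉ⁺¹∣mn)
    ... | inj₁ p∣m              = contradiction p∣m p∤m
    ... | inj₂ (divides-refl q) =
      subst (p * p ^ e ∣_) (*-comm p q) (*-monoʳ-∣ p (prime^∣m*n∧∤m⇒∣n e p∤m pᵉ∣mq))
      where
      m*[q*p]≡p*[m*q] : m * (q * p) ≡ p * (m * q)
      m*[q*p]≡p*[m*q] = trans (sym (*-assoc m q p)) (*-comm (m * q) p)
      pᵉ∣mq : p ^ e ∣ m * q
      pᵉ∣mq = *-cancelˡ-∣ p (subst (p * p ^ e ∣_) m*[q*p]≡p*[m*q] pᵉ⁺¹∣mn)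

    prime^∣[1+n]*n : ∀ {n} e → p ^ e ∣ suc n * n → p ^ e ∣ suc n ⊎ p ^ e ∣ n
    prime^∣[1+n]*n {n} e pᵉ∣ with p ∣? suc n
    ... | no  p∤1+n = inj₂ (prime^∣m*n∧∤m⇒∣n e p∤1+n pᵉ∣)
    ... | yes p∣1+n = inj₁ (prime^∣m*n∧∤m⇒∣n e p∤n (subst (p ^ e ∣_) (*-comm (suc n) n) pᵉ∣))
      where
      p∤n : ¬ p ∣ n
      p∤n p∣n = p∤1 (∣m+n∣m⇒∣n (subst (p ∣_) (+-comm 1 n) p∣1+n) p∣n)

    prime^∣[1+n]*n∧1+n<prime^⇒n≡0 : ∀ {n} e → p ^ e ∣ suc n * n → suc n < p ^ e → n ≡ 0
    prime^∣[1+n]*n∧1+n<prime^⇒n≡0 {n} e pᵉ∣ 1+n<pᵉ with prime^∣[1+n]*n e pᵉ∣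
    ... | inj₁ pᵉ∣1+n = contradiction (∣∧<⇒≡0 pᵉ∣1+n 1+n<pᵉ) λ ()
    ... | inj₂ pᵉ∣n   = ∣∧<⇒≡0 pᵉ∣n (<-trans (n<1+n n) 1+n<pᵉ)

open PrimePowerDivisibility

open import Defs
open import Data.Nat.Properties using (m^n≡0⇒m≡0; m^n≡1⇒n≡0∨m≡1) renaming (_≟_ to _≟ℕ_)
open import Data.Nat.Divisibility using (∣1⇒≡1)
open import Data.Bool.Base using (if_then_else_)
open import Data.Fin.Base using (Fin; zero; suc; _<_)
open import Data.Fin.Properties using (<-cmp; suc-injective; _≟_)
open import Data.Fin.Induction using (>-wellFounded)
open import Data.Fin.Relation.Unary.Top using (view; ‵fromℕ; ‵inject₁)
open import Data.Product using (Σ; ∃; _×_; _,_; proj₁; proj₂)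
open import Induction.WellFounded using (module All)
open import Relation.Binary.Definitions using (tri<; tri≈; tri>)
open import Relation.Nullary.Decidable using (does; dec-true; dec-false)
open import Data.Integer.Base as ℤ using (ℤ; +_; _+_; _*_; _-_)
import Data.Integer.Divisibility as Unsigned
open import Data.Integer.Divisibility.Signed using (_∣_; divides; ∣⇒∣ᵤ)
open import Data.Integer.Properties
  using (pos-*; drop‿+<+; +-injective; <-irrefl; i*j≡0⇒i≡0∨j≡0; i-j≡0⇒i≡j;
         +-identityˡ; +-identityʳ; *-comm; *-zeroˡ; *-zeroʳ; *-identityʳ)
  renaming (_≟_ to _≟ℤ_)
open import Data.Integer.Tactic.RingSolver using (solve-∀)

Σℤ-cong : ∀ {n} {f g : Fin n → ℤ} → (∀ j → f j ≡ g j) → Σℤ f ≡ Σℤ g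
Σℤ-cong {zero}  f≗g = refl
Σℤ-cong {suc n} f≗g = cong₂ _+_ (f≗g zero) (Σℤ-cong (f≗g ∘ suc))

Σℤ-sub : ∀ {n} (f g : Fin n → ℤ) → Σℤ (λ j → f j - g j) ≡ Σℤ f - Σℤ g
Σℤ-sub {zero}  f g = refl
Σℤ-sub {suc n} f g =
  trans (cong (_+_ (f zero - g zero)) (Σℤ-sub (f ∘ suc) (g ∘ suc)))
        (interchange (f zero) (g zero) (Σℤ (f ∘ suc)) (Σℤ (g ∘ suc)))
  where
  interchange : ∀ a b c d → (a - b) + (c - d) ≡ (a + c) - (b + d)
  interchange = solve-∀

Σℤ-zero : ∀ {n} {f : Fin n → ℤ} → (∀ j → f j ≡ + 0) → Σℤ f ≡ + 0
Σℤ-zero {zero}  f≗0 = refl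
Σℤ-zero {suc n} f≗0 = cong₂ _+_ (f≗0 zero) (Σℤ-zero (f≗0 ∘ suc))

Σℤ-single : ∀ {n} (f : Fin n → ℤ) (k : Fin n) → (∀ j → ¬ j ≡ k → f j ≡ + 0) → Σℤ f ≡ f k
Σℤ-single {suc n} f zero    others =
  trans (cong (_+_ (f zero)) (Σℤ-zero (λ j → others (suc j) λ ()))) (+-identityʳ (f zero))
Σℤ-single {suc n} f (suc k) others =
  trans (cong (_+ Σℤ (f ∘ suc)) (others zero λ ()))
    (trans (+-identityˡ _) (Σℤ-single (f ∘ suc) k (λ j j≢k → others (suc j) (j≢k ∘ suc-injective))))

Bit : ℤ → Set
Bit a = a ≡ + 0 ⊎ a ≡ + 1

bit⇒idempotent : ∀ {a} → Bit a → a * a - a ≡ + 0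
bit⇒idempotent (inj₁ refl) = refl
bit⇒idempotent (inj₂ refl) = refl

idempotent⇒bit : ∀ a → a * a - a ≡ + 0 → Bit a
idempotent⇒bit a a²-a≡0 = map₂ (i-j≡0⇒i≡j a (+ 1)) (i*j≡0⇒i≡0∨j≡0 a (trans (factor a) a²-a≡0))
  where
  factor : ∀ a → a * (a - + 1) ≡ a * a - a
  factor = solve-∀

idempotent<prime^⇒bit : ∀ {p} → Prime p → ∀ e {a} → + 0 ℤ.≤ a → a ℤ.< + (p ℕ.^ e)
                      → + (p ℕ.^ e) ∣ a * a - a → Bit a
idempotent<prime^⇒bit     p-prime e {+ zero}  _ _      _        = inj₁ refl
idempotent<prime^⇒bit {p} p-prime e {+ suc n} _ 1+n<pᵉ pᵉ∣a²-a =
  inj₂ (cong (λ k → + suc k) (prime^∣[1+n]*n∧1+n<prime^⇒n≡0 p-prime e pᵉ∣[1+n]*n (drop‿+<+ 1+n<pᵉ)))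
  where
  a²-a≡a*n : + suc n * + suc n - + suc n ≡ + (suc n ℕ.* n)
  a²-a≡a*n = trans (factor (+ n)) (sym (pos-* (suc n) n))
    where
    factor : ∀ N → (+ 1 + N) * (+ 1 + N) - (+ 1 + N) ≡ (+ 1 + N) * N
    factor = solve-∀
  pᵉ∣[1+n]*n : + (p ℕ.^ e) Unsigned.∣ + (suc n ℕ.* n)
  pᵉ∣[1+n]*n = subst (+ (p ℕ.^ e) Unsigned.∣_) a²-a≡a*n (∣⇒∣ᵤ pᵉ∣a²-a)

Σℤ-disjoint-bits : ∀ {n} (f : Fin n → ℤ) → (∀ j → Bit (f j)) → (∀ j k → ¬ j ≡ k → f j * f k ≡ + 0)
                 → (∀ j → f j ≡ + 0) ⊎ (∃ λ j → f j ≡ + 1 × Σℤ f ≡ + 1)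
Σℤ-disjoint-bits {zero}  f bits disjoint = inj₁ λ ()
Σℤ-disjoint-bits {suc n} f bits disjoint
  with bits zero
     | Σℤ-disjoint-bits (f ∘ suc) (bits ∘ suc) (λ j k j≢k → disjoint (suc j) (suc k) (j≢k ∘ suc-injective))
... | inj₁ f₀≡0 | inj₁ rest≡0         = inj₁ λ { zero → f₀≡0 ; (suc j) → rest≡0 j }
... | inj₁ f₀≡0 | inj₂ (j , fj≡1 , Σ≡1) = inj₂ (suc j , fj≡1 , cong₂ _+_ f₀≡0 Σ≡1)
... | inj₂ f₀≡1 | inj₁ rest≡0         = inj₂ (zero , f₀≡1 , cong₂ _+_ f₀≡1 (Σℤ-zero rest≡0))
... | inj₂ f₀≡1 | inj₂ (j , fj≡1 , _)  =
  contradiction (trans (sym (cong₂ _*_ f₀≡1 fj≡1)) (disjoint zero (suc j) λ ())) λ ()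

UpperTriangular : ∀ {n} → Matrix ℤ n → Set
UpperTriangular A = ∀ i j → j < i → A i j ≡ + 0

unitVector : ∀ {n} → Fin n → Fin n → ℤ
unitVector j k = if does (k ≟ j) then + 1 else + 0

unitVector-diag : ∀ {n} (j : Fin n) → unitVector j j ≡ + 1
unitVector-diag j = cong (if_then + 1 else + 0) (dec-true (j ≟ j) refl)

unitVector-off : ∀ {n} {j k : Fin n} → ¬ k ≡ j → unitVector j k ≡ + 0
unitVector-off {j = j} {k} k≢j = cong (if_then + 1 else + 0) (dec-false (k ≟ j) k≢j)

column∈span : ∀ {n} (A : Matrix ℤ n) j → InColSpan A (λ i → A i j)
column∈span A j = unitVector j , λ i → begin
  Σℤ (λ k → A i k * unitVector j k)  ≡⟨ Σℤ-single _ j off-column ⟩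
  A i j * unitVector j j             ≡⟨ cong (A i j *_) (unitVector-diag j) ⟩
  A i j * + 1                        ≡⟨ *-identityʳ (A i j) ⟩
  A i j                              ∎
  where
  open ≡-Reasoning
  off-column : ∀ {i} k → ¬ k ≡ j → A i k * unitVector j k ≡ + 0
  off-column {i} k k≢j = trans (cong (A i k *_) (unitVector-off k≢j)) (*-zeroʳ (A i k))

span-sub : ∀ {n} (A : Matrix ℤ n) {u w} → InColSpan A u → InColSpan A w → InColSpan A (λ i → u i - w i)
span-sub A {u} {w} (x , Ax≗u) (y , Ay≗w) = (λ j → x j - y j) , λ i → begin
  Σℤ (λ j → A i j * (x j - y j))        ≡⟨ Σℤ-cong (λ j → distrib (A i j) (x j) (y j)) ⟩
  Σℤ (λ j → A i j * x j - A i j * y j)  ≡⟨ Σℤ-sub (λ j → A i j * x j) (λ j → A i j * y j) ⟩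
  (A · x) i - (A · y) i                 ≡⟨ cong₂ _-_ (Ax≗u i) (Ay≗w i) ⟩
  u i - w i                             ∎
  where
  open ≡-Reasoning
  distrib : ∀ a b c → a * (b - c) ≡ a * b - a * c
  distrib = solve-∀

triangular-row : ∀ {n} {A : Matrix ℤ n} → UpperTriangular A → ∀ x l → (∀ k → l < k → x k ≡ + 0)
               → (A · x) l ≡ A l l * x l
triangular-row {A = A} triangular x l x>l≡0 = Σℤ-single (λ j → A l j * x j) l off-pivot
  where
  off-pivot : ∀ j → ¬ j ≡ l → A l j * x j ≡ + 0
  off-pivot j j≢l with <-cmp j l
  ... | tri< j<l _ _ = trans (cong (_* x j) (triangular l j j<l)) (*-zeroˡ (x j))
  ... | tri≈ _ j≡l _ = contradiction j≡l j≢l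
  ... | tri> _ _ l<j = trans (cong (A l j *_) (x>l≡0 j l<j)) (*-zeroʳ (A l j))

span-vanishing-criterion : ∀ {n} {A : Matrix ℤ n} {v} → UpperTriangular A → (∀ k → ¬ A k k ≡ + 0)
                         → InColSpan A v → (∀ l → A l l ∣ v l → v l ≡ + 0) → ∀ l → v l ≡ + 0
span-vanishing-criterion {A = A} {v} triangular pivot≢0 (x , Ax≗v) criterion l = begin
  v l          ≡⟨ v≡pivot*x l (λ k _ → x≡0 k) ⟩
  A l l * x l  ≡⟨ cong (A l l *_) (x≡0 l) ⟩
  A l l * + 0  ≡⟨ *-zeroʳ (A l l) ⟩
  + 0          ∎
  where
  open ≡-Reasoning
  v≡pivot*x : ∀ l → (∀ k → l < k → x k ≡ + 0) → v l ≡ A l l * x l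
  v≡pivot*x l x>l≡0 = trans (sym (Ax≗v l)) (triangular-row triangular x l x>l≡0)
  x≡0-step : ∀ l → (∀ k → l < k → x k ≡ + 0) → x l ≡ + 0
  x≡0-step l x>l≡0 = fromInj₂ (λ Aₗₗ≡0 → contradiction Aₗₗ≡0 (pivot≢0 l))
                       (i*j≡0⇒i≡0∨j≡0 (A l l) (trans (sym vₗ≡Aₗₗxₗ) (criterion l Aₗₗ∣vₗ)))
    where
    vₗ≡Aₗₗxₗ : v l ≡ A l l * x l
    vₗ≡Aₗₗxₗ = v≡pivot*x l x>l≡0
    Aₗₗ∣vₗ : A l l ∣ v l
    Aₗₗ∣vₗ = divides (x l) (trans vₗ≡Aₗₗxₗ (*-comm (A l l) (x l)))
  x≡0 : ∀ l → x l ≡ + 0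
  x≡0 = All.wfRec >-wellFounded _ (λ l → x l ≡ + 0) (λ l IH → x≡0-step l (λ k → IH))

hnf-unit-row⇒diagonal : ∀ {n} {A : Matrix ℤ n} {l j} → IsHNF A → A l l ≡ + 1 → A l j ≡ + 1 → l ≡ j
hnf-unit-row⇒diagonal {l = l} {j} (triangular , reduced) Aₗₗ≡1 Aₗⱼ≡1 with <-cmp l j
... | tri< l<j _ _ = contradiction (subst₂ ℤ._<_ Aₗⱼ≡1 Aₗₗ≡1 (proj₂ (reduced l j l<j))) (<-irrefl refl)
... | tri≈ _ l≡j _ = l≡j
... | tri> _ _ j<l = contradiction (trans (sym (triangular l j j<l)) Aₗⱼ≡1) λ ()

module UnitColumns {n p} (p-prime : Prime p) {A : Matrix ℤ n} (hnf : IsHNF A)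
  (1∈span : InColSpan A (λ _ → + 1))
  (⊙-closed : ∀ u w → InColSpan A u → InColSpan A w → InColSpan A (u ⊙ w))
  (pivot-powers : ∀ k → ∃ λ f → A k k ≡ + (p ℕ.^ f))
  where

  triangular : UpperTriangular A
  triangular = proj₁ hnf

  pivot≢0 : ∀ k → ¬ A k k ≡ + 0
  pivot≢0 k Aₖₖ≡0 with pivot-powers k
  ... | f , Aₖₖ≡pᶠ =
    ¬prime[0] (subst Prime (m^n≡0⇒m≡0 p f (+-injective (trans (sym Aₖₖ≡pᶠ) Aₖₖ≡0))) p-prime)

  pivot∣1⇒≡1 : ∀ l → A l l ∣ + 1 → A l l ≡ + 1
  pivot∣1⇒≡1 l Aₗₗ∣1 with pivot-powers l
  ... | f , Aₗₗ≡pᶠ = trans Aₗₗ≡pᶠ (cong +_ (∣1⇒≡1 (∣⇒∣ᵤ (subst (_∣ + 1) Aₗₗ≡pᶠ Aₗₗ∣1))))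

  reduced-entry-bit : ∀ {l j} → l < j → A l l ∣ A l j * A l j - A l j → Bit (A l j)
  reduced-entry-bit {l} {j} l<j Aₗₗ∣ with pivot-powers l | proj₂ hnf l j l<j
  ... | f , Aₗₗ≡pᶠ | 0≤Aₗⱼ , Aₗⱼ<Aₗₗ =
    idempotent<prime^⇒bit p-prime f 0≤Aₗⱼ (subst (A l j ℤ.<_) Aₗₗ≡pᶠ Aₗⱼ<Aₗₗ)
                                          (subst (_∣ A l j * A l j - A l j) Aₗₗ≡pᶠ Aₗₗ∣)

  unitColumn-bits : ∀ {j} → A j j ≡ + 1 → ∀ l → Bit (A l j)
  unitColumn-bits {j} Aⱼⱼ≡1 l =
    idempotent⇒bit (A l j) (span-vanishing-criterion triangular pivot≢0 c²-c∈span criterion l)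
    where
    c²-c∈span : InColSpan A (λ i → A i j * A i j - A i j)
    c²-c∈span = span-sub A (⊙-closed _ _ (column∈span A j) (column∈span A j)) (column∈span A j)
    criterion : ∀ i → A i i ∣ A i j * A i j - A i j → A i j * A i j - A i j ≡ + 0
    criterion i Aᵢᵢ∣ with <-cmp i j
    ... | tri< i<j _ _  = bit⇒idempotent (reduced-entry-bit i<j Aᵢᵢ∣)
    ... | tri≈ _ refl _ = bit⇒idempotent (inj₂ Aⱼⱼ≡1)
    ... | tri> _ _ j<i  = bit⇒idempotent (inj₁ (triangular i j j<i))

  unitColumns-product-criterion : ∀ {j k} → A j j ≡ + 1 → A k k ≡ + 1 → ¬ j ≡ k
                                → ∀ l → A l l ∣ A l j * A l k → A l j * A l k ≡ + 0
  unitColumns-product-criterion {j} {k} Aⱼⱼ≡1 Aₖₖ≡1 j≢k l =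
    bits-criterion (unitColumn-bits Aⱼⱼ≡1 l) (unitColumn-bits Aₖₖ≡1 l)
    where
    bits-criterion : Bit (A l j) → Bit (A l k) → A l l ∣ A l j * A l k → A l j * A l k ≡ + 0
    bits-criterion (inj₁ Aₗⱼ≡0) _            _   = trans (cong (_* A l k) Aₗⱼ≡0) (*-zeroˡ (A l k))
    bits-criterion (inj₂ _)     (inj₁ Aₗₖ≡0) _   = trans (cong (A l j *_) Aₗₖ≡0) (*-zeroʳ (A l j))
    bits-criterion (inj₂ Aₗⱼ≡1) (inj₂ Aₗₖ≡1) Aₗₗ∣ =
      contradiction (trans (sym (hnf-unit-row⇒diagonal hnf Aₗₗ≡1 Aₗⱼ≡1))
                           (hnf-unit-row⇒diagonal hnf Aₗₗ≡1 Aₗₖ≡1)) j≢k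
      where
      Aₗₗ≡1 : A l l ≡ + 1
      Aₗₗ≡1 = pivot∣1⇒≡1 l (subst (A l l ∣_) (cong₂ _*_ Aₗⱼ≡1 Aₗₖ≡1) Aₗₗ∣)

  unitColumns-orthogonal : ∀ {j k} → A j j ≡ + 1 → A k k ≡ + 1 → ¬ j ≡ k → ∀ l → A l j * A l k ≡ + 0
  unitColumns-orthogonal {j} {k} Aⱼⱼ≡1 Aₖₖ≡1 j≢k =
    span-vanishing-criterion triangular pivot≢0 (⊙-closed _ _ (column∈span A j) (column∈span A k))
      (unitColumns-product-criterion Aⱼⱼ≡1 Aₖₖ≡1 j≢k)

  unitColumns-unique : ∀ {j k l} → A j j ≡ + 1 → A k k ≡ + 1 → A l j ≡ + 1 → A l k ≡ + 1 → j ≡ k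
  unitColumns-unique {j} {k} {l} Aⱼⱼ≡1 Aₖₖ≡1 Aₗⱼ≡1 Aₗₖ≡1 with j ≟ k
  ... | yes j≡k = j≡k
  ... | no  j≢k =
    contradiction (trans (sym (cong₂ _*_ Aₗⱼ≡1 Aₗₖ≡1)) (unitColumns-orthogonal Aⱼⱼ≡1 Aₖₖ≡1 j≢k l)) λ ()

  unitIndicator : Fin n → ℤ
  unitIndicator k = if does (A k k ≟ℤ + 1) then + 1 else + 0

  unitIndicator-cases : ∀ k → (A k k ≡ + 1 × unitIndicator k ≡ + 1)
                            ⊎ (¬ A k k ≡ + 1 × unitIndicator k ≡ + 0)
  unitIndicator-cases k with A k k ≟ℤ + 1
  ... | yes Aₖₖ≡1 = inj₁ (Aₖₖ≡1 , refl)
  ... | no  Aₖₖ≢1 = inj₂ (Aₖₖ≢1 , refl)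

  unitPart : Fin n → Fin n → ℤ
  unitPart l j = A l j * unitIndicator j

  unitPart-cases : ∀ l j → (A j j ≡ + 1 × unitPart l j ≡ A l j) ⊎ unitPart l j ≡ + 0
  unitPart-cases l j with unitIndicator-cases j
  ... | inj₁ (Aⱼⱼ≡1 , χⱼ≡1) = inj₁ (Aⱼⱼ≡1 , trans (cong (A l j *_) χⱼ≡1) (*-identityʳ (A l j)))
  ... | inj₂ (_     , χⱼ≡0) = inj₂ (trans (cong (A l j *_) χⱼ≡0) (*-zeroʳ (A l j)))

  unitPart-bits : ∀ l j → Bit (unitPart l j)
  unitPart-bits l j with unitPart-cases l j
  ... | inj₁ (Aⱼⱼ≡1 , part≡Aₗⱼ) = subst Bit (sym part≡Aₗⱼ) (unitColumn-bits Aⱼⱼ≡1 l)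
  ... | inj₂ part≡0            = inj₁ part≡0

  unitPart-disjoint : ∀ l j k → ¬ j ≡ k → unitPart l j * unitPart l k ≡ + 0
  unitPart-disjoint l j k j≢k with unitPart-cases l j | unitPart-cases l k
  ... | inj₁ (Aⱼⱼ≡1 , partⱼ≡Aₗⱼ) | inj₁ (Aₖₖ≡1 , partₖ≡Aₗₖ) =
    trans (cong₂ _*_ partⱼ≡Aₗⱼ partₖ≡Aₗₖ) (unitColumns-orthogonal Aⱼⱼ≡1 Aₖₖ≡1 j≢k l)
  ... | inj₂ partⱼ≡0 | _          = trans (cong (_* unitPart l k) partⱼ≡0) (*-zeroˡ (unitPart l k))
  ... | inj₁ _       | inj₂ partₖ≡0 = trans (cong (unitPart l j *_) partₖ≡0) (*-zeroʳ (unitPart l j))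

  unitPart-pivot : ∀ l → A l l ≡ + 1 → unitPart l l ≡ + 1
  unitPart-pivot l Aₗₗ≡1 with unitIndicator-cases l
  ... | inj₁ (_ , χₗ≡1)    = cong₂ _*_ Aₗₗ≡1 χₗ≡1
  ... | inj₂ (Aₗₗ≢1 , _)   = contradiction Aₗₗ≡1 Aₗₗ≢1

  unitParts-cases : ∀ l → (∀ j → unitPart l j ≡ + 0)
                        ⊎ (∃ λ j → unitPart l j ≡ + 1 × Σℤ (unitPart l) ≡ + 1)
  unitParts-cases l = Σℤ-disjoint-bits (unitPart l) (unitPart-bits l) (unitPart-disjoint l)

  unitColumns-sum≡1 : ∀ l → (A · unitIndicator) l ≡ + 1
  unitColumns-sum≡1 l =
    sym (i-j≡0⇒i≡j (+ 1) _ (span-vanishing-criterion triangular pivot≢0 1-sum∈span criterion l))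
    where
    1-sum∈span : InColSpan A (λ i → + 1 - (A · unitIndicator) i)
    1-sum∈span = span-sub A 1∈span (unitIndicator , λ _ → refl)
    criterion : ∀ i → A i i ∣ + 1 - Σℤ (unitPart i) → + 1 - Σℤ (unitPart i) ≡ + 0
    criterion i Aᵢᵢ∣ with unitParts-cases i
    ... | inj₂ (_ , _ , Σ≡1) = cong (λ s → + 1 - s) Σ≡1
    ... | inj₁ parts≡0       =
      contradiction (trans (sym (parts≡0 i)) (unitPart-pivot i (pivot∣1⇒≡1 i Aᵢᵢ∣1))) λ ()
      where
      Aᵢᵢ∣1 : A i i ∣ + 1
      Aᵢᵢ∣1 = subst (A i i ∣_) (cong (λ s → + 1 - s) (Σℤ-zero parts≡0)) Aᵢᵢ∣

  unitColumn-through : ∀ l → ∃ λ j → A j j ≡ + 1 × A l j ≡ + 1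
  unitColumn-through l with unitParts-cases l
  ... | inj₁ parts≡0 = contradiction (trans (sym (unitColumns-sum≡1 l)) (Σℤ-zero parts≡0)) λ ()
  ... | inj₂ (j , partⱼ≡1 , _) with unitPart-cases l j
  ...   | inj₁ (Aⱼⱼ≡1 , partⱼ≡Aₗⱼ) = j , Aⱼⱼ≡1 , trans (sym partⱼ≡Aₗⱼ) partⱼ≡1
  ...   | inj₂ partⱼ≡0            = contradiction (trans (sym partⱼ≡1) partⱼ≡0) λ ()

module PrimePowerDiagonal {p m} (p-prime : Prime p) {A : Matrix ℤ (suc m)} {e : Fin m → ℕ} (hnf : IsHNF A)
  (1∈span : InColSpan A (λ _ → + 1))
  (⊙-closed : ∀ u w → InColSpan A u → InColSpan A w → InColSpan A (u ⊙ w))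
  (diagonal : HasDiagonal A p e)
  where

  pivot-powers : ∀ k → ∃ λ f → A k k ≡ + (p ℕ.^ f)
  pivot-powers k with view k
  ... | ‵fromℕ      = 0 , proj₂ diagonal
  ... | ‵inject₁ k′ = e k′ , proj₁ diagonal k′

  ∉I⇒unit-pivot : ∀ {j} → ¬ InI e j → A j j ≡ + 1
  ∉I⇒unit-pivot {j} j∉I with view j
  ... | ‵fromℕ     = proj₂ diagonal
  ... | ‵inject₁ k with e k ≟ℕ 0
  ...   | yes eₖ≡0 = trans (proj₁ diagonal k) (cong (λ f → + (p ℕ.^ f)) eₖ≡0)
  ...   | no  eₖ≢0 = contradiction (k , refl , eₖ≢0) j∉I

  unit-pivot⇒∉I : ∀ {j} → A j j ≡ + 1 → ¬ InI e j
  unit-pivot⇒∉I Aⱼⱼ≡1 (k , refl , eₖ≢0)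
    with m^n≡1⇒n≡0∨m≡1 p (e k) (+-injective (trans (sym (proj₁ diagonal k)) Aⱼⱼ≡1))
  ... | inj₁ eₖ≡0 = eₖ≢0 eₖ≡0
  ... | inj₂ refl = ¬prime[1] p-prime

  open UnitColumns p-prime hnf 1∈span ⊙-closed pivot-powers

  ∉I-columns-disjoint : ∀ i {j₁ j₂} → ¬ InI e j₁ → ¬ InI e j₂ → ¬ j₁ ≡ j₂
                      → A i j₁ ≡ + 0 ⊎ A i j₂ ≡ + 0
  ∉I-columns-disjoint i j₁∉I j₂∉I j₁≢j₂ =
    i*j≡0⇒i≡0∨j≡0 (A i _) (unitColumns-orthogonal (∉I⇒unit-pivot j₁∉I) (∉I⇒unit-pivot j₂∉I) j₁≢j₂ i)

  ∉I-unit-column : ∀ i → Σ (Fin (suc m)) λ j → (¬ InI e j × A i j ≡ + 1)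
                                            × (∀ j′ → ¬ InI e j′ → A i j′ ≡ + 1 → j′ ≡ j)
  ∉I-unit-column i = unique (unitColumn-through i)
    where
    unique : (∃ λ j → A j j ≡ + 1 × A i j ≡ + 1)
           → Σ (Fin (suc m)) λ j → (¬ InI e j × A i j ≡ + 1)
                                 × (∀ j′ → ¬ InI e j′ → A i j′ ≡ + 1 → j′ ≡ j)
    unique (j , Aⱼⱼ≡1 , Aᵢⱼ≡1) = j , (unit-pivot⇒∉I Aⱼⱼ≡1 , Aᵢⱼ≡1) ,
      λ j′ j′∉I Aᵢⱼ′≡1 → unitColumns-unique (∉I⇒unit-pivot j′∉I) Aⱼⱼ≡1 Aᵢⱼ′≡1 Aᵢⱼ≡1

proposition4p10 : (p : ℕ) → Prime p → (m : ℕ) → (A : Matrix ℤ (suc m)) → (e : Fin m → ℕ)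
    → IsSubringMatrix A → HasDiagonal A p e
    → ((i j₁ j₂ : Fin (suc m)) → InI e i → ¬ InI e j₁ → ¬ InI e j₂ → ¬ (j₁ ≡ j₂)
         → (A i j₁ ≡ + 0) ⊎ (A i j₂ ≡ + 0))
      × ((i : Fin (suc m)) → InI e i
         → Σ (Fin (suc m)) λ j → (¬ InI e j × A i j ≡ + 1)
             × ((j′ : Fin (suc m)) → ¬ InI e j′ → A i j′ ≡ + 1 → j′ ≡ j))
proposition4p10 p p-prime m A e (_ , hnf , 1∈span , ⊙-closed) diagonal =
  (λ i j₁ j₂ _ → ∉I-columns-disjoint i) , (λ i _ → ∉I-unit-column i)
  where
  open PrimePowerDiagonal p-prime {e = e} hnf 1∈span ⊙-closed diagonal
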